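{- Let $\mathcal{G}$ be a finite quiver (self-loops allowed, at most one directed edge from any vertex to any other vertex), and let $\mu_c,\nu_0,\nu_p$ be vertices. The star-height of the factorized expression for the set of cycles $W_{\mathcal{G};\mu_c\mu_c}$ satisfies $$h(W_{\mathcal{G};\mu_c\mu_c})=\begin{cases}0&\text{if }\Gamma_{\mathcal{G};\mu_c}=\{(\mu_c)\},\\ 1+\displaystyle\max_{(\mu_c\mu_1\cdots\mu_{c-1}\mu_c)\in\Gamma_{\mathcal{G};\mu_c}}\ \max_{1\le i\le c-1} h(W_{\mathcal{G}\setminus\{\mu_c,\mu_1,\dots,\mu_{i-1}\};\mu_i\mu_i})&\text{otherwise,}\end{cases}$$ and the star-height of the factorized expression for the set of open walks $W_{\mathcal{G};\nu_0\nu_p}$ is $$h(W_{\mathcal{G};\nu_0\nu_p})=\max_{(\nu_0\nu_1\cdots\nu_{p-1}\nu_p)\in\Pi_{\mathcal{G};\nu_0\nu_p}}\ \max_{0\le i\le p} h(W_{\mathcal{G}\setminus\{\nu_0,\nu_1,\dots,\nu_{i-1}\};\nu_i\nu_i}).$$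
   Context: Simple paths are open walks with all vertices distinct; $\Pi_{\mathcal{H};\nu_0\nu_p}$ denotes those from $\nu_0$ to $\nu_p$. Simple cycles are cycles whose internal vertices are distinct and different from the initial vertex; $\Gamma_{\mathcal{H};\mu}$ denotes those off $\mu$, including the trivial walk $(\mu)$ and the loop $(\mu\mu)$ if present. $\mathcal{H}\setminus\{\dots\}$ denotes vertex deletion with incident edges. The walk sets are represented by their factorized expressions: $W_{\mathcal{G};\nu_0\nu_p}$ is the union over simple paths $(\nu_0\nu_1\cdots\nu_p)$ of $\big((\{(\nu_0\cdots\nu_p)\}\odot A^\ast_{\mathcal{G}\setminus\{\nu_0,\dots,\nu_{p-1}\};\nu_p})\odot\cdots\odot A^\ast_{\mathcal{G}\setminus\{\nu_0\};\nu_1}\big)\odot A^\ast_{\mathcal{G};\nu_0}$, and $W_{\mathcal{H};\mu\mu}=A^\ast_{\mathcal{H};\mu}$, where $A_{\mathcal{H};\mu_c}$ is the union over simple cycles $(\mu_c\mu_1\cdots\mu_{c-1}\mu_c)\in\Gamma_{\mathcal{H};\mu_c}$ of $\big((\{(\mu_c\mu_1\cdots\mu_c)\}\odot A^\ast_{\mathcal{H}\setminus\{\mu_c,\dots,\mu_{c-2}\};\mu_{c-1}})\odot\cdots\big)\odot A^\ast_{\mathcal{H}\setminus\{\mu_c\};\mu_1}$, with $A_{\mathcal{H};\mu}=\{(\mu\mu)\}$ or $\{(\mu)\}$ (according as the loop exists or not) when $\mu$ has no neighbour in $\mathcal{H}$. Here $\odot$ is the nesting product (insertion of a cycle off $\beta$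 at the last appearance of $\beta$ in a walk, subject to the canonical condition), extended elementwise to sets, and $E^\ast=\bigcup_{i\ge0}E^i$ is the Kleene star ($E^0=\{(\mu)\}$, powers by concatenation). The star-height $h$ of such an expression is the maximal number of nested Kleene stars in it, the star of a set consisting only of a trivial walk not being counted. -}

module Defs where

open import Data.Bool using (Bool; true; false; _∧_; not; if_then_else_; T)
open import Data.Nat using (ℕ; zero; suc; _⊔_)
open import Data.Fin using (Fin)
open import Data.Fin.Properties using () renaming (_≟_ to _≟ᶠ_)
open import Data.Fin.Subset using (Subset; _-_)
open import Data.List using (List; []; _∷_; _++_; map; concat; concatMap; allFin; filterᵇ; length)
open import Data.Bool.ListAction using (any)
import Data.Vec as Vec
open import Relation.Nullary.Decidable using (⌊_⌋)

-- Vertices are Fin n; since there is at most one directed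
-- edge from any vertex to any vertex (self-loops allowed), the edge set is
-- a relation, given by its (Boolean) adjacency function.

Quiver : ℕ → Set
Quiver n = Fin n → Fin n → Bool

-- A vertex-induced subgraph H of G is given by its vertex set S : Subset n
-- (the edges of H are the edges of G between vertices of S).
-- Vertex deletion H \ {v₁,…,vₖ}:

deleteAll : ∀ {n} → Subset n → List (Fin n) → Subset n
deleteAll S []       = S
deleteAll S (v ∷ vs) = deleteAll (S - v) vs

module _ {n : ℕ} (G : Quiver n) where

  inS : Subset n → Fin n → Bool
  inS S v = Vec.lookup S v

  isWalk : Subset n → List (Fin n) → Bool
  isWalk S []           = false
  isWalk S (v ∷ [])     = inS S v
  isWalk S (u ∷ v ∷ ws) = G u v ∧ inS S u ∧ isWalk S (v ∷ ws)

  _==_ : Fin n → Fin n → Bool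
  u == v = ⌊ u ≟ᶠ v ⌋

  elem : Fin n → List (Fin n) → Bool
  elem v ws = any (v ==_) ws

  distinct : List (Fin n) → Bool
  distinct []       = true
  distinct (v ∷ ws) = not (elem v ws) ∧ distinct ws

  startsAt : Fin n → List (Fin n) → Bool
  startsAt a []      = false
  startsAt a (v ∷ _) = a == v

  endsAt : Fin n → List (Fin n) → Bool
  endsAt b []           = false
  endsAt b (v ∷ [])     = b == v
  endsAt b (_ ∷ v ∷ ws) = endsAt b (v ∷ ws)

  isSimplePath : Subset n → Fin n → Fin n → List (Fin n) → Bool
  isSimplePath S a b w = isWalk S w ∧ startsAt a w ∧ endsAt b w ∧ distinct w

  -- Simple cycle off μ in H: a walk (μ μ₁ ⋯ μ_{c-1} μ) whose internal
  -- vertices are distinct and different from μ, i.e. the tail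
  -- (μ₁ ⋯ μ_{c-1} μ) is duplicate-free.  This includes the trivial walk (μ)
  -- and the loop (μ μ) if present.
  isSimpleCycle : Subset n → Fin n → List (Fin n) → Bool
  isSimpleCycle S μ []       = false
  isSimpleCycle S μ (v ∷ ws) =
    isWalk S (v ∷ ws) ∧ startsAt μ (v ∷ ws) ∧ endsAt μ (v ∷ ws) ∧ distinct ws

  seqsOfLength : ℕ → List (List (Fin n))
  seqsOfLength zero    = [] ∷ []
  seqsOfLength (suc k) = concatMap (λ v → map (v ∷_) (seqsOfLength k)) (allFin n)

  seqsUpTo : ℕ → List (List (Fin n))
  seqsUpTo zero    = seqsOfLength zero
  seqsUpTo (suc k) = seqsUpTo k ++ seqsOfLength (suc k)

  -- Π_{H;ab} and Γ_{H;μ}, listed (without repetitions).  A simple path has at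
  -- most n vertices, a simple cycle at most n+1 vertex occurrences.
  Π : Subset n → Fin n → Fin n → List (List (Fin n))
  Π S a b = filterᵇ (isSimplePath S a b) (seqsUpTo n)

  Γ : Subset n → Fin n → List (List (Fin n))
  Γ S μ = filterᵇ (isSimpleCycle S μ) (seqsUpTo (suc n))

-- Internal vertices (μ₁ ⋯ μ_{c-1}) of a cycle (μ_c μ₁ ⋯ μ_{c-1} μ_c);
-- empty for (μ) and (μ μ).
dropLast : ∀ {A : Set} → List A → List A
dropLast []           = []
dropLast (x ∷ [])     = []
dropLast (x ∷ y ∷ xs) = x ∷ dropLast (y ∷ xs)

inner : ∀ {A : Set} → List A → List A
inner []       = []
inner (x ∷ xs) = dropLast xs

data Expr (n : ℕ) : Set where
  ⟨_⟩  : List (Fin n) → Expr n          -- the singleton set {w}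
  ⋃    : List (Expr n) → Expr n
  _⊙_  : Expr n → Expr n → Expr n       -- nesting product
  _⋆   : Expr n → Expr n

-- "The expression denotes a set consisting only of a trivial walk".
-- (Decided syntactically.)
mutual
  trivialSet : ∀ {n} → Expr n → Bool
  trivialSet ⟨ _ ∷ [] ⟩ = true
  trivialSet ⟨ _ ⟩      = false
  trivialSet (⋃ [])     = false
  trivialSet (⋃ (e ∷ es)) = trivialSet e ∧ trivialSets es
  trivialSet (e ⊙ f)    = trivialSet e ∧ trivialSet f
  trivialSet (e ⋆)      = trivialSet e

  trivialSets : ∀ {n} → List (Expr n) → Bool
  trivialSets []       = true
  trivialSets (e ∷ es) = trivialSet e ∧ trivialSets es

mutual
  h : ∀ {n} → Expr n → ℕ
  h ⟨ _ ⟩   = 0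
  h (⋃ es)  = hs es
  h (e ⊙ f) = h e ⊔ h f
  h (e ⋆)   = if trivialSet e then h e else suc (h e)

  hs : ∀ {n} → List (Expr n) → ℕ
  hs []       = 0
  hs (e ∷ es) = h e ⊔ hs es

maxOver : ∀ {A : Set} → List A → (A → ℕ) → ℕ
maxOver []       f = 0
maxOver (x ∷ xs) f = f x ⊔ maxOver xs f

-- ((({w} ⊙ Eₚ) ⊙ ⋯) ⊙ E₀)  for the list E₀ ∷ ⋯ ∷ Eₚ
nestAll : ∀ {n} → Expr n → List (Expr n) → Expr n
nestAll e []       = e
nestAll e (x ∷ xs) = nestAll e xs ⊙ x

module _ {n : ℕ} (G : Quiver n) where

  hasNeighbour : Subset n → Fin n → Bool
  hasNeighbour S μ =
    any (λ v → not (_==_ G μ v) ∧ inS G S v ∧ (G μ v Data.Bool.∨ G v μ)) (allFin n)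

  -- A_{H;μ}, defined by recursion on a fuel parameter k (each recursive
  -- call is on a graph with μ deleted; fuel n is always sufficient).
  mutual
    A : ℕ → Subset n → Fin n → Expr n
    A zero    S μ = ⟨ μ ∷ [] ⟩
    A (suc k) S μ =
      if hasNeighbour S μ
        then ⋃ (cycleTerms k S μ (Γ G S μ))
        else (if G μ μ then ⟨ μ ∷ μ ∷ [] ⟩ else ⟨ μ ∷ [] ⟩)

    cycleTerms : ℕ → Subset n → Fin n → List (List (Fin n)) → List (Expr n)
    cycleTerms k S μ []       = []
    cycleTerms k S μ (w ∷ ws) =
      nestAll ⟨ w ⟩ (stars k (S - μ) (inner w)) ∷ cycleTerms k S μ ws

    -- A*_{H;ν₀}, A*_{H\{ν₀};ν₁}, …, A*_{H\{ν₀,…,ν_{p-1}};νₚ}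
    stars : ℕ → Subset n → List (Fin n) → List (Expr n)
    stars k S []       = []
    stars k S (v ∷ vs) = (A k S v ⋆) ∷ stars k (S - v) vs

  Wcyc : Subset n → Fin n → Expr n
  Wcyc S μ = A n S μ ⋆

  -- W_{H;ν₀νₚ} = ⋃_{paths} ((({(ν₀⋯νₚ)} ⊙ A*_{…;νₚ}) ⊙ ⋯) ⊙ A*_{H;ν₀}
  Wopen : Subset n → Fin n → Fin n → Expr n
  Wopen S a b = ⋃ (map (λ w → nestAll ⟨ w ⟩ (stars n S w)) (Π G S a b))

-- Both formulas are read off the recursive shape of the expressions:
-- h commutes with unions and nesting products as a maximum, and a star
-- adds one exactly when its body is not a set of trivial walks.
--
-- The expressions are built with a fuel parameter, whereas the
-- right-hand sides use W_{H;μμ} = A*_{H;μ} at the full fuel n.  The one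
-- genuinely structural fact is therefore FUEL STABILITY (A-stable): the
-- fuel only has to reach the number of vertices of H, because every
-- recursive call deletes a vertex.  It rests on a cardinality count for
-- the distinct internal vertices of a simple cycle (inner-fresh).
--
-- For cycles we further need: every simple cycle is listed in Γ
-- (Γ-complete, by a pigeonhole bound on its length), nontrivial cycles
-- make the union nontrivial, and a vertex without neighbours only has the
-- cycles (μ) and (μμ) (isolated-cycles).

module Submission where

open import Defs
open import Data.Bool using (Bool; true; false; T; not; _∧_; _∨_)
open import Data.Bool.Properties using (T-≡; T-not-≡; T-∧; ∧-zeroʳ)
open import Data.Empty using (⊥-elim)
open import Data.Fin using (Fin; toℕ; zero; suc)
open import Data.Fin.Properties using (_≟_)
open import Data.Fin.Subset using (Subset; ⊤; _-_; ⁅_⁆; ∣_∣) renaming (_∈_ to _∈ₛ_)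
open import Data.Fin.Subset.Properties
  using (∈⊤; ∣p∣≤n; ∣⊤∣≡n; ∣p─q∣≤∣p∣; x∈p⇒∣p-x∣<∣p∣; x∈p∧x≢y⇒x∈p-y)
open import Data.List using (List; []; _∷_; map; allFin; tabulate; length; lookup; take)
open import Data.List.Properties using (≡-dec; map-tabulate)
open import Data.List.Membership.Propositional using (_∈_; find; lose)
open import Data.List.Membership.Propositional.Properties
  using (∈-allFin; ∈-map⁺; ∈-concatMap⁺; ∈-++⁺ˡ; ∈-++⁺ʳ; ∈-filter⁺; ∈-filter⁻)
open import Data.List.Relation.Unary.All as All using (All; []; _∷_; all?)
open import Data.List.Relation.Unary.All.Properties using (¬All⇒Any¬)
open import Data.List.Relation.Unary.AllPairs using ([]; _∷_)
open import Data.List.Relation.Unary.Any using (here; there)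
open import Data.List.Relation.Unary.Any.Properties using (any⁺)
open import Data.List.Relation.Unary.Unique.Propositional using (Unique)
open import Data.Nat using (ℕ; zero; suc; _⊔_; _≤_; z≤n; s≤s)
open import Data.Nat.Properties
  using (≤-trans; ≤-pred; m≤n⇒m<n∨m≡n; ⊔-identityʳ; ⊔-assoc; ⊔-comm)
open import Data.Product using (∃-syntax; _×_; _,_; proj₁; proj₂; uncurry)
open import Data.Sum using (_⊎_; inj₁; inj₂)
open import Data.Vec.Properties using (lookup⇒[]=; []=⇒lookup)
open import Function using (_∘_)
open import Function.Bundles using (Equivalence)
open import Relation.Binary.PropositionalEquality
  using (_≡_; _≢_; refl; sym; trans; cong; cong₂; subst; module ≡-Reasoning)
open import Relation.Nullary using (¬_; Dec; yes; no)
open import Relation.Nullary.Decidable using (T?; toWitness; fromWitness; fromWitnessFalse)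

open ≡-Reasoning

maxOver-cong : ∀ {X : Set} {F F′ : X → ℕ} {xs : List X} →
  All (λ x → F x ≡ F′ x) xs → maxOver xs F ≡ maxOver xs F′
maxOver-cong []       = refl
maxOver-cong (e ∷ es) = cong₂ _⊔_ e (maxOver-cong es)

maxOver-zero : ∀ {X : Set} {F : X → ℕ} {xs : List X} →
  All (λ x → F x ≡ 0) xs → maxOver xs F ≡ 0
maxOver-zero []       = refl
maxOver-zero (e ∷ es) rewrite e = maxOver-zero es

maxOver-map : ∀ {X Y : Set} (f : X → Y) (F : Y → ℕ) (xs : List X) →
  maxOver (map f xs) F ≡ maxOver xs (F ∘ f)
maxOver-map f F []       = refl
maxOver-map f F (x ∷ xs) = cong (F (f x) ⊔_) (maxOver-map f F xs)

hs-map : ∀ {n} {X : Set} (f : X → Expr n) (xs : List X) →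
  hs (map f xs) ≡ maxOver xs (h ∘ f)
hs-map f []       = refl
hs-map f (x ∷ xs) = cong (h (f x) ⊔_) (hs-map f xs)

h-nestAll : ∀ {n} (e : Expr n) (xs : List (Expr n)) → h (nestAll e xs) ≡ h e ⊔ hs xs
h-nestAll e []       = sym (⊔-identityʳ (h e))
h-nestAll e (x ∷ xs) = begin
  h (nestAll e xs) ⊔ h x  ≡⟨ cong (_⊔ h x) (h-nestAll e xs) ⟩
  h e ⊔ hs xs ⊔ h x       ≡⟨ ⊔-assoc (h e) (hs xs) (h x) ⟩
  h e ⊔ (hs xs ⊔ h x)     ≡⟨ cong (h e ⊔_) (⊔-comm (hs xs) (h x)) ⟩
  h e ⊔ (h x ⊔ hs xs)     ∎

nestAll-nontrivial : ∀ {n} (e : Expr n) (xs : List (Expr n)) →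
  trivialSet e ≡ false → trivialSet (nestAll e xs) ≡ false
nestAll-nontrivial e []       t = t
nestAll-nontrivial e (x ∷ xs) t rewrite nestAll-nontrivial e xs t = refl

h-⋆-trivial : ∀ {n} (e : Expr n) → trivialSet e ≡ true → h (e ⋆) ≡ h e
h-⋆-trivial e t rewrite t = refl

h-⋆-nontrivial : ∀ {n} (e : Expr n) → trivialSet e ≡ false → h (e ⋆) ≡ suc (h e)
h-⋆-nontrivial e t rewrite t = refl

⊆-minus : ∀ {n} {S : Subset n} {v : Fin n} {vs : List (Fin n)} →
  All (_∈ₛ S) vs → All (v ≢_) vs → All (_∈ₛ S - v) vs
⊆-minus vs⊆S v∉vs =
  All.zipWith (λ (x∈S , v≢x) → x∈p∧x≢y⇒x∈p-y x∈S (v≢x ∘ sym)) (vs⊆S , v∉vs)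

unique⊆-length : ∀ {n} (S : Subset n) (vs : List (Fin n)) →
  Unique vs → All (_∈ₛ S) vs → length vs ≤ ∣ S ∣
unique⊆-length S []       _              _             = z≤n
unique⊆-length S (v ∷ vs) (v∉vs ∷ uniq) (v∈S ∷ vs⊆S) =
  ≤-trans (s≤s (unique⊆-length (S - v) vs uniq (⊆-minus vs⊆S v∉vs)))
          (x∈p⇒∣p-x∣<∣p∣ v∈S)

unique-length : ∀ {n} (vs : List (Fin n)) → Unique vs → length vs ≤ n
unique-length {n} vs uniq =
  subst (length vs ≤_) (∣⊤∣≡n n) (unique⊆-length ⊤ vs uniq (All.universal (λ _ → ∈⊤) vs))

minus-bound : ∀ {n k} {S : Subset n} {μ : Fin n} → μ ∈ₛ S → ∣ S ∣ ≤ suc k → ∣ S - μ ∣ ≤ k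
minus-bound μ∈S le = ≤-pred (≤-trans (x∈p⇒∣p-x∣<∣p∣ μ∈S) le)

All-dropLast : ∀ {A : Set} {P : A → Set} {ys : List A} → All P ys → All P (dropLast ys)
All-dropLast []               = []
All-dropLast (p ∷ [])         = []
All-dropLast (p ∷ ps@(_ ∷ _)) = p ∷ All-dropLast ps

isTrivialWalk? : ∀ {n} (μ : Fin n) (w : List (Fin n)) → Dec (w ≡ μ ∷ [])
isTrivialWalk? μ w = ≡-dec _≟_ w (μ ∷ [])

module _ {n : ℕ} (G : Quiver n) where

  ∧-split : ∀ a {b} → T (a ∧ b) → T a × T b
  ∧-split a = Equivalence.to (T-∧ {a})

  ==-sound : ∀ {u v} → T (_==_ G u v) → u ≡ v
  ==-sound {u} {v} = toWitness {a? = u ≟ v}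

  ==-refl : ∀ u → _==_ G u u ≡ true
  ==-refl u = Equivalence.to T-≡ (fromWitness {a? = u ≟ u} refl)

  ==-false : ∀ {u v} → u ≢ v → _==_ G u v ≡ false
  ==-false {u} {v} u≢v = Equivalence.to T-not-≡ (fromWitnessFalse {a? = u ≟ v} u≢v)

  inS⇒∈ : ∀ {S v} → T (inS G S v) → v ∈ₛ S
  inS⇒∈ {S} {v} t = lookup⇒[]= v S (Equivalence.to T-≡ t)

  walk-⊆ : ∀ {S} ws → T (isWalk G S ws) → All (_∈ₛ S) ws
  walk-⊆     (v ∷ [])     t = inS⇒∈ t ∷ []
  walk-⊆ {S} (u ∷ v ∷ ws) t =
    let (_ , rest) = ∧-split (G u v) t ; (u∈S , walk) = ∧-split (inS G S u) rest
    in inS⇒∈ u∈S ∷ walk-⊆ (v ∷ ws) walk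

  notElem⇒fresh : ∀ {v} ws → T (not (elem G v ws)) → All (v ≢_) ws
  notElem⇒fresh         []       _     = []
  notElem⇒fresh {v} (x ∷ ws) fresh with v ≟ x
  ... | yes _  = ⊥-elim fresh   -- fresh : T (not true)
  ... | no v≢x = v≢x ∷ notElem⇒fresh ws fresh

  distinct⇒Unique : ∀ ws → T (distinct G ws) → Unique ws
  distinct⇒Unique []       _ = []
  distinct⇒Unique (v ∷ ws) t =
    let (fresh , rest) = ∧-split (not (elem G v ws)) t in notElem⇒fresh ws fresh ∷ distinct⇒Unique ws rest

  endsAt-∈ : ∀ {μ} y ys → T (endsAt G μ (y ∷ ys)) → μ ∈ y ∷ ys
  endsAt-∈ y []       e = here (==-sound e)
  endsAt-∈ y (z ∷ zs) e = there (endsAt-∈ z zs e)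

  IsCycle : Subset n → Fin n → List (Fin n) → Set
  IsCycle S μ w = T (isSimpleCycle G S μ w)

  cycle-view : ∀ {S μ} w → IsCycle S μ w →
    ∃[ ws ] (w ≡ μ ∷ ws × T (isWalk G S w) × T (endsAt G μ w) × Unique ws)
  cycle-view {S} {μ} (v ∷ ws) c =
    let (walk , rest)     = ∧-split (isWalk G S (v ∷ ws)) c
        (starts , rest′)  = ∧-split (startsAt G μ (v ∷ ws)) rest
        (ends , dist)     = ∧-split (endsAt G μ (v ∷ ws)) rest′
    in ws , cong (_∷ ws) (sym (==-sound starts)) , walk , ends , distinct⇒Unique ws dist

  trivial-cycle : ∀ {S μ} → μ ∈ₛ S → IsCycle S μ (μ ∷ [])
  trivial-cycle {μ = μ} μ∈S rewrite []=⇒lookup μ∈S | ==-refl μ = _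

  loop-cycle : ∀ {S μ} → μ ∈ₛ S → T (G μ μ) → IsCycle S μ (μ ∷ μ ∷ [])
  loop-cycle {μ = μ} μ∈S loop rewrite Equivalence.to T-≡ loop | []=⇒lookup μ∈S | ==-refl μ = _

  -- A simple cycle has at most n+1 vertex occurrences: its tail is duplicate-free.
  cycle-length : ∀ {S μ} w → IsCycle S μ w → length w ≤ suc n
  cycle-length w c with cycle-view w c
  ... | ws , refl , _ , _ , uniq = s≤s (unique-length ws uniq)

  dropLast-fresh : ∀ {S μ v} ys → T (endsAt G μ (v ∷ ys)) → All (_∈ₛ S) ys → Unique ys →
    All (_∈ₛ S - μ) (dropLast ys) × Unique (dropLast ys)
  dropLast-fresh []           _    _             _             = [] , []
  dropLast-fresh (y ∷ [])     _    _             _             = [] , []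
  dropLast-fresh (y ∷ z ∷ zs) ends (y∈S ∷ zs⊆S) (y∉zs ∷ uniq) =
    let (rest⊆ , restUnique) = dropLast-fresh {v = y} (z ∷ zs) ends zs⊆S uniq
        y≢μ = All.lookup y∉zs (endsAt-∈ z zs ends)
    in x∈p∧x≢y⇒x∈p-y y∈S y≢μ ∷ rest⊆ , All-dropLast y∉zs ∷ restUnique

  inner-fresh : ∀ {S μ} w → IsCycle S μ w → All (_∈ₛ S - μ) (inner w) × Unique (inner w)
  inner-fresh w c with cycle-view w c
  ... | ws , refl , walk , ends , uniq = dropLast-fresh ws ends (All.tail (walk-⊆ w walk)) uniq

  cycle-nontrivial : ∀ {S μ} w → IsCycle S μ w → w ≢ μ ∷ [] → trivialSet ⟨ w ⟩ ≡ false
  cycle-nontrivial w c w≢μ with cycle-view w c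
  ... | []    , refl , _ = ⊥-elim (w≢μ refl)
  ... | _ ∷ _ , refl , _ = refl

  neighbour-witness : ∀ {S μ y} → T (G μ y) → y ∈ₛ S → μ ≢ y → T (hasNeighbour G S μ)
  neighbour-witness {S} {μ} {y} edge y∈S μ≢y = any⁺ isNeighbour (lose (∈-allFin y) y-isNeighbour)
    where
      isNeighbour : Fin n → Bool
      isNeighbour v = not (_==_ G μ v) ∧ inS G S v ∧ (G μ v ∨ G v μ)
      y-isNeighbour : T (isNeighbour y)
      y-isNeighbour rewrite ==-false μ≢y | []=⇒lookup y∈S | Equivalence.to T-≡ edge = _

  isolated-cycles : ∀ {S μ} → hasNeighbour G S μ ≡ false → ∀ w → IsCycle S μ w →
    w ≡ μ ∷ [] ⊎ (w ≡ μ ∷ μ ∷ [] × T (G μ μ))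
  isolated-cycles {μ = μ} isolated w c with cycle-view w c
  ... | [] , refl , _ = inj₁ refl
  ... | y ∷ ys , refl , walk , ends , uniq with y ≟ μ
  ...   | no y≢μ = ⊥-elim (subst T isolated
            (neighbour-witness (proj₁ (∧-split (G μ y) walk))
               (All.lookup (walk-⊆ (μ ∷ y ∷ ys) walk) (there (here refl))) (y≢μ ∘ sym)))
  ...   | yes refl with ys | uniq
  ...     | []     | _           = inj₂ (refl , proj₁ (∧-split (G μ μ) walk))
  ...     | z ∷ zs | μ∉zs ∷ _    = ⊥-elim (All.lookup μ∉zs (endsAt-∈ z zs ends) refl)

  isolated-inner : ∀ {S μ} → hasNeighbour G S μ ≡ false → ∀ w → IsCycle S μ w → inner w ≡ []
  isolated-inner isolated w c with isolated-cycles isolated w c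
  ... | inj₁ refl       = refl
  ... | inj₂ (refl , _) = refl

  -- Γ lists exactly the simple cycles: every short vertex sequence is
  -- enumerated, and simple cycles are short (cycle-length).

  ∈-seqsOfLength : ∀ w → w ∈ seqsOfLength G (length w)
  ∈-seqsOfLength []      = here refl
  ∈-seqsOfLength (v ∷ w) =
    ∈-concatMap⁺ (λ u → map (u ∷_) (seqsOfLength G (length w)))
      (lose (∈-allFin v) (∈-map⁺ (v ∷_) (∈-seqsOfLength w)))

  ∈-seqsUpTo : ∀ k w → length w ≤ k → w ∈ seqsUpTo G k
  ∈-seqsUpTo zero    []  _  = here refl
  ∈-seqsUpTo (suc k) w   le with m≤n⇒m<n∨m≡n le
  ... | inj₁ (s≤s lt) = ∈-++⁺ˡ (∈-seqsUpTo k w lt)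
  ... | inj₂ len      = ∈-++⁺ʳ (seqsUpTo G k) (subst (λ j → w ∈ seqsOfLength G j) len (∈-seqsOfLength w))

  Γ-sound : ∀ {S μ w} → w ∈ Γ G S μ → IsCycle S μ w
  Γ-sound {S} {μ} w∈Γ = proj₂ (∈-filter⁻ (T? ∘ isSimpleCycle G S μ) {xs = seqsUpTo G (suc n)} w∈Γ)

  Γ-complete : ∀ {S μ} w → IsCycle S μ w → w ∈ Γ G S μ
  Γ-complete {S} {μ} w c =
    ∈-filter⁺ (T? ∘ isSimpleCycle G S μ) (∈-seqsUpTo (suc n) w (cycle-length w c)) c

  trivialCyclesListed : ∀ {S μ} → (∀ w → isSimpleCycle G S μ w ≡ true → w ≡ μ ∷ []) →
    All (_≡ μ ∷ []) (Γ G S μ)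
  trivialCyclesListed triv = All.tabulate (λ {w} w∈Γ → triv w (Equivalence.to T-≡ (Γ-sound w∈Γ)))

  -- Constructively, a nontrivial cycle is found by searching the finite list Γ.
  nontrivialCycleListed : ∀ {S μ} → ¬ (∀ w → isSimpleCycle G S μ w ≡ true → w ≡ μ ∷ []) →
    ∃[ w ] (w ∈ Γ G S μ × w ≢ μ ∷ [])
  nontrivialCycleListed {S} {μ} ¬triv with all? (isTrivialWalk? μ) (Γ G S μ)
  ... | yes allTrivial =
    ⊥-elim (¬triv (λ w c → All.lookup allTrivial (Γ-complete w (Equivalence.from T-≡ c))))
  ... | no ¬allTrivial = find (¬All⇒Any¬ (isTrivialWalk? μ) _ ¬allTrivial)

  -- Height of the star list A*_{S;v₀}, A*_{S∖{v₀};v₁}, … attached along vs,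
  -- in the indexed form used by the theorem.
  starsHeight : ℕ → Subset n → List (Fin n) → ℕ
  starsHeight k S vs =
    maxOver (allFin (length vs)) (λ i → h (A G k (deleteAll S (take (toℕ i) vs)) (lookup vs i) ⋆))

  hs-stars : ∀ k S vs → hs (stars G k S vs) ≡ starsHeight k S vs
  hs-stars k S []       = refl
  hs-stars k S (v ∷ vs) = cong (h (A G k S v ⋆) ⊔_) (begin
    hs (stars G k (S - v) vs)                              ≡⟨ hs-stars k (S - v) vs ⟩
    maxOver (allFin (length vs)) (F ∘ suc)                 ≡⟨ maxOver-map suc F (allFin (length vs)) ⟨
    maxOver (map suc (allFin (length vs))) F               ≡⟨ cong (λ is → maxOver is F) (map-tabulate (λ i → i) suc) ⟩
    maxOver (tabulate suc) F                               ∎)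
    where F = λ i → h (A G k (deleteAll S (take (toℕ i) (v ∷ vs))) (lookup (v ∷ vs) i) ⋆)

  hs-cycleTerms : ∀ k S μ ws →
    hs (cycleTerms G k S μ ws) ≡ maxOver ws (λ w → hs (stars G k (S - μ) (inner w)))
  hs-cycleTerms k S μ []       = refl
  hs-cycleTerms k S μ (w ∷ ws) =
    cong₂ _⊔_ (h-nestAll ⟨ w ⟩ (stars G k (S - μ) (inner w))) (hs-cycleTerms k S μ ws)

  cycleTerms-cong : ∀ {k k′} S μ {ws} →
    All (λ w → stars G k (S - μ) (inner w) ≡ stars G k′ (S - μ) (inner w)) ws →
    cycleTerms G k S μ ws ≡ cycleTerms G k′ S μ ws
  cycleTerms-cong S μ []       = refl
  cycleTerms-cong S μ (e ∷ es) = cong₂ _∷_ (cong (nestAll ⟨ _ ⟩) e) (cycleTerms-cong S μ es)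

  -- Fuel stability: once the fuel reaches ∣ S ∣, more fuel changes nothing,
  -- since each recursive call deletes a vertex (the internal vertices of a
  -- cycle, resp. the vertices of a star list, are distinct vertices of S).
  mutual
    A-stable : ∀ k S μ → ∣ S ∣ ≤ k → μ ∈ₛ S → A G k S μ ≡ A G (suc k) S μ
    A-stable zero    S μ le μ∈S with ≤-trans (x∈p⇒∣p-x∣<∣p∣ μ∈S) le
    ... | ()
    A-stable (suc k) S μ le μ∈S
      rewrite cycleTerms-cong {k} {suc k} S μ
                (All.tabulate (λ {w} w∈Γ → innerStars-stable k S μ le μ∈S w (Γ-sound w∈Γ)))
      = refl

    innerStars-stable : ∀ k S μ → ∣ S ∣ ≤ suc k → μ ∈ₛ S → ∀ w → IsCycle S μ w →
      stars G k (S - μ) (inner w) ≡ stars G (suc k) (S - μ) (inner w)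
    innerStars-stable k S μ le μ∈S w c =
      uncurry (stars-stable k (S - μ) (inner w) (minus-bound μ∈S le)) (inner-fresh w c)

    stars-stable : ∀ k S vs → ∣ S ∣ ≤ k → All (_∈ₛ S) vs → Unique vs →
      stars G k S vs ≡ stars G (suc k) S vs
    stars-stable k S []       _  _             _             = refl
    stars-stable k S (v ∷ vs) le (v∈S ∷ vs⊆S) (v∉vs ∷ uniq) =
      cong₂ _∷_ (cong _⋆ (A-stable k S v le v∈S))
                (stars-stable k (S - v) vs (≤-trans (∣p─q∣≤∣p∣ S ⁅ v ⁆) le) (⊆-minus vs⊆S v∉vs) uniq)

  trivialCycleTerms : ∀ k S μ {ws} → All (_≡ μ ∷ []) ws →
    trivialSets (cycleTerms G k S μ ws) ≡ true × hs (cycleTerms G k S μ ws) ≡ 0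
  trivialCycleTerms k S μ []          = refl , refl
  trivialCycleTerms k S μ (refl ∷ ps) = trivialCycleTerms k S μ ps

  -- Hence, the list being nonempty, the starred union has height 0.
  h-trivialUnion : ∀ k S μ ws → μ ∷ [] ∈ ws → All (_≡ μ ∷ []) ws →
    h (⋃ (cycleTerms G k S μ ws) ⋆) ≡ 0
  h-trivialUnion k S μ (_ ∷ ws) _ (refl ∷ ps) =
    trans (h-⋆-trivial (⋃ (cycleTerms G k S μ ((μ ∷ []) ∷ ws))) (proj₁ (trivialCycleTerms k S μ ps)))
          (proj₂ (trivialCycleTerms k S μ ps))

  -- A listed cycle of length at least two makes its term, hence the union,
  -- nontrivial (for a nonempty list, ⋃ is trivial iff all its terms are).
  terms-nontrivial : ∀ k S μ {w} ws → w ∈ ws → trivialSet ⟨ w ⟩ ≡ false →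
    trivialSets (cycleTerms G k S μ ws) ≡ false
  terms-nontrivial k S μ (x ∷ xs) (here refl) t
    rewrite nestAll-nontrivial ⟨ x ⟩ (stars G k (S - μ) (inner x)) t = refl
  terms-nontrivial k S μ (x ∷ xs) (there w∈) t
    rewrite terms-nontrivial k S μ xs w∈ t = ∧-zeroʳ _

  union-nontrivial : ∀ k S μ {w} ws → w ∈ ws → trivialSet ⟨ w ⟩ ≡ false →
    trivialSet (⋃ (cycleTerms G k S μ ws)) ≡ false
  union-nontrivial k S μ (x ∷ xs) = terms-nontrivial k S μ (x ∷ xs)

  -- h(W_{H;μμ}) = 0 when (μ) is the only simple cycle off μ; in particular
  -- an isolated μ carries no loop.
  h-A⋆-trivial : ∀ k S μ → μ ∈ₛ S → All (_≡ μ ∷ []) (Γ G S μ) → h (A G (suc k) S μ ⋆) ≡ 0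
  h-A⋆-trivial k S μ μ∈S triv with hasNeighbour G S μ
  ... | true  = h-trivialUnion k S μ (Γ G S μ) (Γ-complete (μ ∷ []) (trivial-cycle μ∈S)) triv
  ... | false with G μ μ in loop
  ...   | false = refl
  ...   | true  with All.lookup triv (Γ-complete (μ ∷ μ ∷ []) (loop-cycle μ∈S (Equivalence.from T-≡ loop)))
  ...     | ()

  -- h(W_{H;μμ}) = 1 + max over simple cycles of the heights of the nested
  -- stars.  Without neighbours the cycle must be the loop, A = {(μμ)} and
  -- all internal star lists are empty.
  h-A⋆-nontrivial : ∀ k S μ → μ ∈ₛ S → ∣ S ∣ ≤ suc k → ∃[ w ] (w ∈ Γ G S μ × w ≢ μ ∷ []) →
    h (A G (suc k) S μ ⋆) ≡ suc (maxOver (Γ G S μ) (λ w → starsHeight (suc k) (S - μ) (inner w)))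
  h-A⋆-nontrivial k S μ μ∈S le (w , w∈Γ , w≢μ) with hasNeighbour G S μ in neighbours
  ... | true = begin
    h (⋃ terms ⋆)                                                   ≡⟨ h-⋆-nontrivial (⋃ terms) nontrivial ⟩
    suc (hs terms)                                                  ≡⟨ cong suc (hs-cycleTerms k S μ (Γ G S μ)) ⟩
    suc (maxOver (Γ G S μ) (λ v → hs (stars G k (S - μ) (inner v)))) ≡⟨ cong suc (maxOver-cong (All.tabulate stable)) ⟩
    suc (maxOver (Γ G S μ) (λ v → starsHeight (suc k) (S - μ) (inner v))) ∎
    where
      terms = cycleTerms G k S μ (Γ G S μ)
      nontrivial = union-nontrivial k S μ (Γ G S μ) w∈Γ (cycle-nontrivial w (Γ-sound w∈Γ) w≢μ)
      stable : ∀ {v} → v ∈ Γ G S μ →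
        hs (stars G k (S - μ) (inner v)) ≡ starsHeight (suc k) (S - μ) (inner v)
      stable {v} v∈Γ = trans (cong hs (innerStars-stable k S μ le μ∈S v (Γ-sound v∈Γ)))
                             (hs-stars (suc k) (S - μ) (inner v))
  ... | false with isolated-cycles neighbours w (Γ-sound w∈Γ)
  ...   | inj₁ refl          = ⊥-elim (w≢μ refl)
  ...   | inj₂ (refl , loop) rewrite Equivalence.to T-≡ loop =
    cong suc (sym (maxOver-zero (All.tabulate (λ {v} v∈Γ →
      cong (starsHeight (suc k) (S - μ)) (isolated-inner neighbours v (Γ-sound v∈Γ))))))

  h-Wopen : ∀ S a b → h (Wopen G S a b) ≡ maxOver (Π G S a b) (starsHeight n S)
  h-Wopen S a b = begin
    hs (map pathTerm (Π G S a b))              ≡⟨ hs-map pathTerm (Π G S a b) ⟩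
    maxOver (Π G S a b) (h ∘ pathTerm)         ≡⟨ maxOver-cong (All.universal heightOf (Π G S a b)) ⟩
    maxOver (Π G S a b) (starsHeight n S)      ∎
    where
      pathTerm = λ w → nestAll ⟨ w ⟩ (stars G n S w)
      heightOf : ∀ w → h (pathTerm w) ≡ starsHeight n S w
      heightOf w = trans (h-nestAll ⟨ w ⟩ (stars G n S w)) (hs-stars n S w)

proposition4 : ∀ {n} (G : Quiver n) (μc ν₀ νₚ : Fin n) →
    ((∀ w → isSimpleCycle G ⊤ μc w ≡ true → w ≡ μc ∷ []) →
      h (Wcyc G ⊤ μc) ≡ 0)
    × (¬ (∀ w → isSimpleCycle G ⊤ μc w ≡ true → w ≡ μc ∷ []) →
      h (Wcyc G ⊤ μc)
        ≡ suc (maxOver (Γ G ⊤ μc) (λ w →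
                 maxOver (allFin (length (inner w))) (λ j →
                   h (Wcyc G (deleteAll (⊤ - μc) (take (toℕ j) (inner w)))
                             (lookup (inner w) j))))))
    × (h (Wopen G ⊤ ν₀ νₚ)
        ≡ maxOver (Π G ⊤ ν₀ νₚ) (λ w →
            maxOver (allFin (length w)) (λ i →
              h (Wcyc G (deleteAll ⊤ (take (toℕ i) w)) (lookup w i)))))
proposition4 {zero}  G () _ _
proposition4 {suc m} G μc ν₀ νₚ =
    (λ triv  → h-A⋆-trivial G m ⊤ μc ∈⊤ (trivialCyclesListed G triv))
  , (λ ¬triv → h-A⋆-nontrivial G m ⊤ μc ∈⊤ (∣p∣≤n ⊤) (nontrivialCycleListed G ¬triv))
  , h-Wopen G ⊤ ν₀ νₚ
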